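{- Let $E$ be a presentation of a graded equational theory $=_E$ over a $\mathbb{\Phi}$-graded signature $\mathcal{F}$. For all terms $u,v,t$, all $\varepsilon\in\Omega$ and all positions $p\in\mathit{Pos}(t)$: if $\varepsilon\Vdash u=_E v$, then $\partial_p(t)(\varepsilon)\Vdash t[u]_p=_E t[v]_p$.
   Context: $\mathbb{\Omega}=(\Omega,\precsim,\otimes,\kappa)$ is a fixed Lawverean quantale: a commutative monoid with a complete lattice order $\precsim$ (joins $\vee$), $\otimes$ distributing over arbitrary joins, $\kappa$ the top element, $\kappa\neq\bot$, and $\alpha\otimes\beta=\bot$ only if $\alpha=\bot$ or $\beta=\bot$. A CBE is a monotone map $\Omega\to\Omega$ preserving $\kappa$, $\otimes$ and arbitrary joins; $\mathbb{\Phi}$ is a fixed set of CBEs containing the identity $\mathbb{1}$ and the constant map $\kappa^\star$, closed under composition and pointwise $\otimes$. A $\mathbb{\Phi}$-graded signature $\mathcal{F}$ gives each $n$-ary symbol $f$ a modal arity $(\phi_1,\dots,\phi_n)\in\Phi^n$, written $f:(\phi_1,\dots,\phi_n)$. For a term $t$ and position $p$: $\partial_\lambda(t)=\mathbb{1}$ ($\lambda$ the root position) and $\partial_{i.p}(f(t_1,\dots,t_n))=\phi_i\circ\partial_p(t_i)$. $E$ is a set of triples $\varepsilon\Vdash t\approx_E s$ ($t,s$ terms, $\varepsilon\in\Omega$). $=_E$ is the least set of triples $\varepsilon\Vdash t=_E s$ closed under: (Ax) $\varepsilon\Vdash t\approx_E s\Rightarrow\varepsilon\Vdash t=_E s$;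 (Refl) $\kappa\Vdash t=_E t$; (Sym) $\varepsilon\Vdash t=_E s\Rightarrow\varepsilon\Vdash s=_E t$; (Trans) $\varepsilon\Vdash t=_E s,\ \delta\Vdash s=_E r\Rightarrow\varepsilon\otimes\delta\Vdash t=_E r$; (Ampl) $\varepsilon_i\Vdash t_i=_E s_i$ ($i=1..n$), $f:(\phi_1,\dots,\phi_n)\Rightarrow\phi_1(\varepsilon_1)\otimes\cdots\otimes\phi_n(\varepsilon_n)\Vdash f(t_1,\dots,t_n)=_E f(s_1,\dots,s_n)$; (Subst) $\varepsilon\Vdash t=_E s\Rightarrow\varepsilon\Vdash t\sigma=_E s\sigma$; (Ord) $\varepsilon\Vdash t=_E s,\ \delta\precsim\varepsilon\Rightarrow\delta\Vdash t=_E s$; (Join) $\varepsilon_i\Vdash t=_E s$ ($i=1..n$) $\Rightarrow\varepsilon_1\vee\cdots\vee\varepsilon_n\Vdash t=_E s$. -}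

module Defs where

open import Data.Nat using (ℕ; zero; suc)
open import Data.Fin using (Fin; zero; suc; _≟_)
open import Data.Empty using (⊥)
open import Data.Sum using (_⊎_)
open import Relation.Nullary using (¬_; Dec; yes; no)
open import Relation.Binary.PropositionalEquality using (_≡_; refl)
open import Data.Product using (Σ; _×_)

record LawvereanQuantale : Set₁ where
  infix  4 _≾_
  infixl 7 _⊗_
  field
    Ω       : Set
    _≾_     : Ω → Ω → Set
    ≾-refl  : ∀ {x} → x ≾ x
    ≾-trans : ∀ {x y z} → x ≾ y → y ≾ z → x ≾ z
    ≾-antisym : ∀ {x y} → x ≾ y → y ≾ x → x ≡ y
    ⋁       : {I : Set} → (I → Ω) → Ω
    ⋁-ub    : ∀ {I : Set} (f : I → Ω) (i : I) → f i ≾ ⋁ f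
    ⋁-least : ∀ {I : Set} (f : I → Ω) (x : Ω) → (∀ i → f i ≾ x) → ⋁ f ≾ x
    _⊗_     : Ω → Ω → Ω
    κ       : Ω
    ⊗-assoc : ∀ x y z → (x ⊗ y) ⊗ z ≡ x ⊗ (y ⊗ z)
    ⊗-comm  : ∀ x y → x ⊗ y ≡ y ⊗ x
    ⊗-identityˡ : ∀ x → κ ⊗ x ≡ x
    ⊗-distrib-⋁ : ∀ {I : Set} (x : Ω) (f : I → Ω) → x ⊗ ⋁ f ≡ ⋁ (λ i → x ⊗ f i)
    κ-top   : ∀ x → x ≾ κ

  bot : Ω
  bot = ⋁ {⊥} (λ ())

  field
    κ≢bot     : ¬ (κ ≡ bot)
    no-zero-divisors : ∀ x y → x ⊗ y ≡ bot → x ≡ bot ⊎ y ≡ bot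

  ⨂ : ∀ {n} → (Fin n → Ω) → Ω
  ⨂ {zero}  f = κ
  ⨂ {suc n} f = f zero ⊗ ⨂ (λ i → f (suc i))

-- Change of base endomaps (CBEs)

module _ (Q : LawvereanQuantale) where
  open LawvereanQuantale Q

  record CBE : Set₁ where
    field
      app      : Ω → Ω
      monotone : ∀ {x y} → x ≾ y → app x ≾ app y
      pres-κ   : app κ ≡ κ
      pres-⊗   : ∀ x y → app (x ⊗ y) ≡ app x ⊗ app y
      pres-⋁   : ∀ {I : Set} (i₀ : I) (f : I → Ω) → app (⋁ f) ≡ ⋁ (λ i → app (f i))

open CBE public

module _ {Q : LawvereanQuantale} where
  open LawvereanQuantale Q
  open import Relation.Binary.PropositionalEquality using (sym; trans; cong)

  𝟙 : CBE Q
  𝟙 = record { app = λ x → x ; monotone = λ p → p ; pres-κ = refl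
             ; pres-⊗ = λ _ _ → refl ; pres-⋁ = λ _ _ → refl }


  _∘ᶜ_ : CBE Q → CBE Q → CBE Q
  φ ∘ᶜ ψ = record
    { app      = λ x → app φ (app ψ x)
    ; monotone = λ p → monotone φ (monotone ψ p)
    ; pres-κ   = trans (cong (app φ) (pres-κ ψ)) (pres-κ φ)
    ; pres-⊗   = λ x y → trans (cong (app φ) (pres-⊗ ψ x y)) (pres-⊗ φ _ _)
    ; pres-⋁   = λ i₀ f → trans (cong (app φ) (pres-⋁ ψ i₀ f)) (pres-⋁ φ i₀ _)
    }

-- The fixed set Φ of CBEs, given as a predicate on CBEs, containing the
-- identity 𝟙 and the constant map κ⋆, closed under composition and
-- pointwise ⊗.  (Membership of a map is stated extensionally: some member
-- of Φ has that map as underlying function.)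

record CBESet (Q : LawvereanQuantale) : Set₂ where
  open LawvereanQuantale Q
  field
    _∈Φ   : CBE Q → Set₁
    𝟙∈Φ   : Σ (CBE Q) λ χ → (χ ∈Φ) × (∀ x → app χ x ≡ x)
    κ⋆∈Φ  : Σ (CBE Q) λ χ → (χ ∈Φ) × (∀ x → app χ x ≡ κ)
    ∘-closed : ∀ φ ψ → φ ∈Φ → ψ ∈Φ →
               Σ (CBE Q) λ χ → (χ ∈Φ) × (∀ x → app χ x ≡ app φ (app ψ x))
    ⊗-closed : ∀ φ ψ → φ ∈Φ → ψ ∈Φ →
               Σ (CBE Q) λ χ → (χ ∈Φ) × (∀ x → app χ x ≡ app φ x ⊗ app ψ x)

record GradedSignature (Q : LawvereanQuantale) (Φ : CBESet Q) : Set₂ where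
  open CBESet Φ
  field
    Sym   : Set
    arity : Sym → ℕ
    grade : (f : Sym) → Fin (arity f) → CBE Q
    grade∈Φ : ∀ f i → grade f i ∈Φ

module Terms {Q : LawvereanQuantale} {Φ : CBESet Q}
             (F : GradedSignature Q Φ) (V : Set) where
  open LawvereanQuantale Q
  open GradedSignature F

  data Term : Set where
    var : V → Term
    fun : (f : Sym) → (Fin (arity f) → Term) → Term

  _⟪_⟫ : Term → (V → Term) → Term
  var x    ⟪ σ ⟫ = σ x
  fun f ts ⟪ σ ⟫ = fun f (λ i → ts i ⟪ σ ⟫)

  data Pos : Term → Set where
    root  : ∀ {t} → Pos t
    _∙_   : ∀ {f ts} (i : Fin (arity f)) → Pos (ts i) → Pos (fun f ts)

  _[_]at_ : (t : Term) → Term → Pos t → Term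
  t        [ u ]at root    = u
  fun f ts [ u ]at (i ∙ p) = fun f (λ j → rep j (j ≟ i))
    where
      rep : (j : Fin (arity f)) → Dec (j ≡ i) → Term
      rep j (yes refl) = ts i [ u ]at p
      rep j (no _)     = ts j

  ∂ : (t : Term) → Pos t → CBE Q
  ∂ t        root    = 𝟙
  ∂ (fun f ts) (i ∙ p) = grade f i ∘ᶜ ∂ (ts i) p

  Presentation : Set₁
  Presentation = Ω → Term → Term → Set

  infix 3 _∣_⊩_≐_
  data _∣_⊩_≐_ (E : Presentation) : Ω → Term → Term → Set where
    ax    : ∀ {ε t s} → E ε t s → E ∣ ε ⊩ t ≐ s
    refl≐ : ∀ {t} → E ∣ κ ⊩ t ≐ t
    sym≐  : ∀ {ε t s} → E ∣ ε ⊩ t ≐ s → E ∣ ε ⊩ s ≐ t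
    trans≐ : ∀ {ε δ t s r} → E ∣ ε ⊩ t ≐ s → E ∣ δ ⊩ s ≐ r → E ∣ ε ⊗ δ ⊩ t ≐ r
    ampl  : ∀ {f} {ts ss : Fin (arity f) → Term} {εs : Fin (arity f) → Ω} →
            (∀ i → E ∣ εs i ⊩ ts i ≐ ss i) →
            E ∣ ⨂ (λ i → app (grade f i) (εs i)) ⊩ fun f ts ≐ fun f ss
    subst≐ : ∀ {ε t s} (σ : V → Term) → E ∣ ε ⊩ t ≐ s → E ∣ ε ⊩ t ⟪ σ ⟫ ≐ s ⟪ σ ⟫
    ord   : ∀ {ε δ t s} → E ∣ ε ⊩ t ≐ s → δ ≾ ε → E ∣ δ ⊩ t ≐ s
    join  : ∀ {n} {t s} {εs : Fin (suc n) → Ω} →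
            (∀ i → E ∣ εs i ⊩ t ≐ s) → E ∣ ⋁ εs ⊩ t ≐ s

{-# OPTIONS --safe #-}
-- At a position i.p of f(t₁,…,tₙ), apply the
-- amplification rule with the induction hypothesis in argument i and
-- reflexivity (grade κ) in every other argument: CBEs preserve κ and κ is
-- the unit of ⊗, so the grade of the conclusion collapses to φᵢ(∂ₚ(tᵢ)(ε)).
module Submission where

open import Defs
open import Data.Nat using (ℕ)
open import Data.Fin using (Fin; zero; suc; _≟_)
open import Data.Fin.Properties using (suc-injective)
open import Data.Vec.Functional using (updateAt)
open import Data.Vec.Functional.Properties using (updateAt-updates; updateAt-minimal)
open import Function using (const)
open import Relation.Nullary using (yes; no; contradiction)
open import Relation.Binary.PropositionalEquality
  using (_≡_; _≢_; refl; sym; trans; cong; cong₂; subst; subst₂)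

module _ {Q : LawvereanQuantale} where
  open LawvereanQuantale Q

  ⨂-κ : ∀ {n} (h : Fin n → Ω) → (∀ j → h j ≡ κ) → ⨂ h ≡ κ
  ⨂-κ {ℕ.zero}  h h≡κ = refl
  ⨂-κ {ℕ.suc n} h h≡κ =
    trans (cong₂ _⊗_ (h≡κ zero) (⨂-κ (λ j → h (suc j)) (λ j → h≡κ (suc j))))
          (⊗-identityˡ κ)

  ⨂-κ-except : ∀ {n} (h : Fin n → Ω) (i : Fin n) →
               (∀ j → j ≢ i → h j ≡ κ) → ⨂ h ≡ h i
  ⨂-κ-except h zero h≡κ =
    trans (cong (h zero ⊗_) (⨂-κ (λ j → h (suc j)) (λ j → h≡κ (suc j) λ ())))
          (trans (⊗-comm _ _) (⊗-identityˡ _))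
  ⨂-κ-except h (suc i) h≡κ =
    trans (cong (_⊗ ⨂ (λ j → h (suc j))) (h≡κ zero λ ()))
          (trans (⊗-identityˡ _)
                 (⨂-κ-except (λ j → h (suc j)) i
                             (λ j j≢i → h≡κ (suc j) (λ sj≡si → j≢i (suc-injective sj≡si)))))

module Replacement {Q : LawvereanQuantale} {Φ : CBESet Q}
                   (F : GradedSignature Q Φ) (V : Set) where
  open LawvereanQuantale Q
  open GradedSignature F
  open Terms F V

  rootArity : Term → ℕ
  rootArity (var _)   = 0
  rootArity (fun f _) = arity f

  arguments : (t : Term) → Fin (rootArity t) → Term
  arguments (var _)    ()
  arguments (fun f ts) = ts

  []at-∙-here : ∀ {f ts} (i : Fin (arity f)) (p : Pos (ts i)) (u : Term) →
                arguments (fun f ts [ u ]at (i ∙ p)) i ≡ ts i [ u ]at p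
  []at-∙-here i p u with i ≟ i
  ... | yes refl = refl
  ... | no i≢i   = contradiction refl i≢i

  []at-∙-there : ∀ {f ts} (i : Fin (arity f)) (p : Pos (ts i)) (u : Term) {j} →
                 j ≢ i → arguments (fun f ts [ u ]at (i ∙ p)) j ≡ ts j
  []at-∙-there i p u {j} j≢i with j ≟ i
  ... | yes j≡i = contradiction j≡i j≢i
  ... | no _    = refl

  module _ (E : Presentation) where

    ampl-at : ∀ {f} {ts ss : Fin (arity f) → Term} {δ} (i : Fin (arity f)) →
              E ∣ δ ⊩ ts i ≐ ss i → (∀ j → j ≢ i → ts j ≡ ss j) →
              E ∣ app (grade f i) δ ⊩ fun f ts ≐ fun f ss
    ampl-at {f} {ts} {ss} {δ} i tsᵢ≐ssᵢ ts≡ss =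
      subst (λ γ → E ∣ γ ⊩ fun f ts ≐ fun f ss) ⨂-grades (ampl componentwise)
      where
        εs : Fin (arity f) → Ω
        εs = updateAt (const κ) i (const δ)

        componentwise : ∀ j → E ∣ εs j ⊩ ts j ≐ ss j
        componentwise j with j ≟ i
        ... | yes refl rewrite updateAt-updates i {const δ} (const κ) = tsᵢ≐ssᵢ
        ... | no j≢i rewrite updateAt-minimal j i {const δ} (const κ) j≢i
                           | ts≡ss j j≢i = refl≐

        ⨂-grades : ⨂ (λ j → app (grade f j) (εs j)) ≡ app (grade f i) δ
        ⨂-grades =
          trans (⨂-κ-except _ i λ j j≢i →
                   trans (cong (app (grade f j)) (updateAt-minimal j i (const κ) j≢i))
                         (pres-κ (grade f j)))
                (cong (app (grade f i)) (updateAt-updates i (const κ)))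

    []at-cong : ∀ (u v t : Term) (ε : Ω) (p : Pos t) →
                E ∣ ε ⊩ u ≐ v → E ∣ app (∂ t p) ε ⊩ t [ u ]at p ≐ t [ v ]at p
    []at-cong u v t          ε root    u≐v = u≐v
    []at-cong u v (fun f ts) ε (i ∙ p) u≐v =
      ampl-at i
        (subst₂ (λ a b → E ∣ app (∂ (ts i) p) ε ⊩ a ≐ b)
                (sym ([]at-∙-here i p u)) (sym ([]at-∙-here i p v))
                ([]at-cong u v (ts i) ε p u≐v))
        (λ j j≢i → trans ([]at-∙-there i p u j≢i) (sym ([]at-∙-there i p v j≢i)))

lemma1 : (Q : LawvereanQuantale) (Φ : CBESet Q) (F : GradedSignature Q Φ) (V : Set)
         (E : Terms.Presentation F V) →
         let open LawvereanQuantale Q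
             open Terms F V
         in ∀ (u v t : Term) (ε : Ω) (p : Pos t) →
            E ∣ ε ⊩ u ≐ v →
            E ∣ app (∂ t p) ε ⊩ t [ u ]at p ≐ t [ v ]at p
lemma1 Q Φ F V E = Replacement.[]at-cong F V E
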